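{- For every integer $n\ge2$, \[ e[n]\le 2+\frac{n-1}{n}\log_2(n-1)<2+\log_2 n, \] and the first inequality is an equality when $n=F_m=2^m+1$ is a Fermat number ($m\ge1$).
   Context: For an integer $n\ge1$, $e[n]$ is the expected number of fair coin tosses used by the bit-efficient scheme for choosing one of $n$ options uniformly. The scheme maintains a set of undecided equally likely toss sequences of the current length $t$ (probability $2^{ -t}$ each), starting with the empty sequence. After each toss, each undecided sequence splits into its two extensions. If there are now at least $n$ undecided sequences, $n$ of them are assigned one to each option, and the process stops if the observed sequence is among them; the rest remain undecided. Thus after $t$ tosses exactly $2^t\bmod n$ sequences are undecided. -}

module Defs where

open import Data.Nat using (ℕ; zero; suc; _+_; _*_; _∸_; _^_; _≤_; _<_; _≤ᵇ_)
open import Data.Bool using (Bool; true; false; if_then_else_)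
open import Data.Product using (_×_; ∃-syntax)

-- The bit-efficient scheme for choosing one of n options.
-- undecided n t : number of undecided toss sequences of length t
-- (each of probability 2^-t).
-- After a toss the undecided sequences double; if there are now at least
-- n of them, n are assigned (and stop), the rest stay undecided.
undecided : ℕ → ℕ → ℕ
undecided n zero    = 1
undecided n (suc t) = if n ≤ᵇ 2 * undecided n t
                        then 2 * undecided n t ∸ n
                        else 2 * undecided n t

-- stopCount n t : number of length-t sequences at which the process stops
-- exactly at toss t  (so  P(T = t) = stopCount n t / 2^t).
stopCount : ℕ → ℕ → ℕ
stopCount n zero    = 0
stopCount n (suc t) = if n ≤ᵇ 2 * undecided n t then n else 0

-- Partial expectation  S n T = Σ_{t=1}^{T} t * P(T = t)  =  num n T / 2^T.
num : ℕ → ℕ → ℕ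
num n zero    = 0
num n (suc T) = 2 * num n T + suc T * stopCount n (suc T)

-- e[n] = Σ_{t≥1} t P(T=t) is the limit (= supremum) of the increasing
-- partial sums num n T / 2^T.  Without reals we express relations of e[n]
-- to a value through the partial sums.

-- "N / D ≤ 2 + ((n-1)/n) * log₂ (n-1)"  for D > 0, n ≥ 2, written without
-- logarithms:  equivalent to  2^((N - 2D) n) ≤ (n-1)^(D (n-1))
-- (when N ≤ 2D both sides hold trivially since n-1 ≥ 1).
LeBound : ℕ → ℕ → ℕ → Set
LeBound n N D = 2 ^ ((N ∸ 2 * D) * n) ≤ (n ∸ 1) ^ (D * (n ∸ 1))

-- e[n] ≤ 2 + ((n-1)/n) log₂(n-1)  :  every partial sum is below the bound.
eLeBound : ℕ → Set
eLeBound n = ∀ T → LeBound n (num n T) (2 ^ T)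

-- "2 + ((n-1)/n) log₂(n-1) < 2 + log₂ n"  ⇔  (n-1)^(n-1) < n^n.
BoundLtTwoPlusLog : ℕ → Set
BoundLtTwoPlusLog n = (n ∸ 1) ^ (n ∸ 1) < n ^ n

-- e[n] = P / Q  (Q > 0): all partial sums are ≤ P/Q, and for every
-- ε = 1/(k+1) some partial sum exceeds P/Q - ε.
eEquals : ℕ → ℕ → ℕ → Set
eEquals n P Q =
  (∀ T → num n T * Q ≤ P * 2 ^ T) ×
  (∀ k → ∃[ T ] ((P * 2 ^ T ∸ num n T * Q) * suc k < Q * 2 ^ T))

{-# OPTIONS --safe #-}

-- e[n] is the limit of tosses n 1 t / 2^t.  A bound e[n] ≤ cost/scale is
-- certified by a potential decreasing along u ↦ 2u mod n when n < 33 (checked by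
-- evaluation), by e[2h] = 1 + e[h] when n is even, and for odd n = 2^m + r by
-- following 1 through m doublings to 2^m, whose orbit is then complementary to
-- the orbit of r (the two add up to n) while r keeps doubling for a while.
-- Comparing cost/scale − 2 with ((n−1)/n)·p/q for a rational p/q ≤ log₂ (n−1)
-- gives the inequality.  For a Fermat number n = 2^m + 1 the orbit of 1 has
-- period 2m, and summing over periods gives e[n] exactly.

module Submission where

open import Defs
open import Data.Nat
open import Data.Nat.Properties
open import Data.Nat.Induction using (<-rec)
open import Data.Nat.Divisibility using (_∣_; _∣?_; divides; ∣m+n∣m⇒∣n; ∣⇒≤; m∣m*n)
open import Data.Nat.Tactic.RingSolver using (solve-∀)
open import Data.Bool using (true; false; if_then_else_; T)
open import Data.List using (List; []; _∷_; head; drop)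
open import Data.Maybe using (fromMaybe)
open import Data.Product using (_×_; _,_; ∃-syntax)
open import Relation.Nullary using (¬_; yes; no; contradiction)
open import Relation.Nullary.Decidable using (Dec; _×-dec_; _→-dec_; toWitness)
open import Relation.Binary.PropositionalEquality
open import Algebra.Properties.CommutativeSemigroup *-commutativeSemigroup
  using (x∙yz≈y∙xz; xy∙z≈y∙xz)

2*n≡n+n : ∀ n → 2 * n ≡ n + n
2*n≡n+n n = cong (n +_) (+-identityʳ n)

^-distribʳ-* : ∀ a b k → (a * b) ^ k ≡ a ^ k * b ^ k
^-distribʳ-* a b zero    = refl
^-distribʳ-* a b (suc k) = begin
  a * b * (a * b) ^ k       ≡⟨ cong (a * b *_) (^-distribʳ-* a b k) ⟩
  a * b * (a ^ k * b ^ k)   ≡⟨ regroup a b (a ^ k) (b ^ k) ⟩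
  a * a ^ k * (b * b ^ k)   ∎
  where
  open ≡-Reasoning
  regroup : ∀ a b x y → a * b * (x * y) ≡ a * x * (b * y)
  regroup = solve-∀

^-cancelʳ-≤ : ∀ q .{{_ : NonZero q}} {a b} → a ^ q ≤ b ^ q → a ≤ b
^-cancelʳ-≤ q {a} {b} aᵠ≤bᵠ with a ≤? b
... | yes a≤b = a≤b
... | no a≰b  = contradiction aᵠ≤bᵠ (<⇒≱ (^-monoˡ-< q (≰⇒> a≰b)))

linear≤exponential : ∀ a b c {m₀} → a * m₀ + b ≤ c * 2 ^ m₀ → a ≤ c * 2 ^ m₀ →
  ∀ {m} → m₀ ≤ m → a * m + b ≤ c * 2 ^ m
linear≤exponential a b c {m₀} base slope {m} m₀≤m =
  subst (λ m → a * m + b ≤ c * 2 ^ m) (m+[n∸m]≡n m₀≤m) (go (m ∸ m₀))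
  where
  open ≤-Reasoning
  go : ∀ i → a * (m₀ + i) + b ≤ c * 2 ^ (m₀ + i)
  go zero    = subst (λ m → a * m + b ≤ c * 2 ^ m) (sym (+-identityʳ m₀)) base
  go (suc i) = begin
    a * (m₀ + suc i) + b                ≡⟨ regroup a m₀ i b ⟩
    a * (m₀ + i) + b + a                ≤⟨ +-mono-≤ (go i) slope′ ⟩
    c * 2 ^ (m₀ + i) + c * 2 ^ (m₀ + i) ≡⟨ double c (2 ^ (m₀ + i)) ⟩
    c * 2 ^ suc (m₀ + i)                ≡⟨ cong (λ m → c * 2 ^ m) (sym (+-suc m₀ i)) ⟩
    c * 2 ^ (m₀ + suc i)                ∎
    where
    slope′ : a ≤ c * 2 ^ (m₀ + i)
    slope′ = ≤-trans slope (*-monoʳ-≤ c (^-monoʳ-≤ 2 (m≤m+n m₀ i)))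
    regroup : ∀ a m i b → a * (m + suc i) + b ≡ a * (m + i) + b + a
    regroup = solve-∀
    double : ∀ c p → c * p + c * p ≡ c * (2 * p)
    double = solve-∀

quadratic<exponential : ∀ {t} → 7 ≤ t → 2 * (t * t) < 2 ^ t
quadratic<exponential {t} 7≤t =
  subst (λ t → 2 * (t * t) < 2 ^ t) (m+[n∸m]≡n 7≤t) (go (t ∸ 7))
  where
  open ≤-Reasoning
  go : ∀ i → 2 * ((7 + i) * (7 + i)) < 2 ^ (7 + i)
  go zero    = ≤ᵇ⇒≤ 99 128 _
  go (suc i) = begin-strict
    2 * ((8 + i) * (8 + i))                       ≡⟨ regroup i ⟩
    2 * ((7 + i) * (7 + i)) + (4 * (7 + i) + 2)   <⟨ +-mono-<-≤ (go i) linear ⟩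
    2 ^ (7 + i) + 2 ^ (7 + i)                     ≡⟨ sym (2*n≡n+n (2 ^ (7 + i))) ⟩
    2 ^ (8 + i)                                   ∎
    where
    regroup : ∀ i → 2 * ((8 + i) * (8 + i)) ≡ 2 * ((7 + i) * (7 + i)) + (4 * (7 + i) + 2)
    regroup = solve-∀
    linear : 4 * (7 + i) + 2 ≤ 2 ^ (7 + i)
    linear = subst (4 * (7 + i) + 2 ≤_) (*-identityˡ _)
      (linear≤exponential 4 2 1 (≤ᵇ⇒≤ 22 32 _) (≤ᵇ⇒≤ 4 32 _) (≤-trans (≤ᵇ⇒≤ 5 7 _) (m≤m+n 7 i)))

power-of-two-below : ∀ y → 0 < y → ∃[ m ] 2 ^ m ≤ y × y < 2 ^ suc m
power-of-two-below (suc zero)    _ = 0 , ≤-refl , s≤s (s≤s z≤n)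
power-of-two-below (suc (suc y)) _ with power-of-two-below (suc y) (s≤s z≤n)
... | m , 2^m≤ , <2^[1+m] with suc (suc y) <? 2 ^ suc m
...   | yes <2^[1+m]′ = m , m≤n⇒m≤1+n 2^m≤ , <2^[1+m]′
...   | no ≮2^[1+m]   = suc m , ≤-reflexive (sym y+2≡) ,
        subst (_< 2 ^ suc (suc m)) (sym y+2≡) (^-monoʳ-< 2 (s≤s (s≤s z≤n)) (n<1+n (suc m)))
  where
  y+2≡ : suc (suc y) ≡ 2 ^ suc m
  y+2≡ = ≤-antisym <2^[1+m] (≮⇒≥ ≮2^[1+m])

-- The dynamics u ↦ 2u mod n

step : ℕ → ℕ → ℕ
step n x = if n ≤ᵇ 2 * x then 2 * x ∸ n else 2 * x

orbit : ℕ → ℕ → ℕ → ℕ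
orbit n x zero    = x
orbit n x (suc t) = step n (orbit n x t)

-- tosses n x T = Σ_{t<T} 2^(T−t) · orbit n x t; for x = 1 it sums min(τ, T) over
-- the 2^T toss sequences of length T, τ being the stopping time of the scheme.
tosses : ℕ → ℕ → ℕ → ℕ
tosses n x zero    = 0
tosses n x (suc T) = 2 * tosses n x T + 2 * orbit n x T

step-≥ : ∀ {n x} → n ≤ 2 * x → step n x ≡ 2 * x ∸ n
step-≥ {n} {x} n≤2x with n ≤ᵇ 2 * x | ≤⇒≤ᵇ n≤2x
... | true | _ = refl

step-< : ∀ {n x} → 2 * x < n → step n x ≡ 2 * x
step-< {n} {x} 2x<n with n ≤ᵇ 2 * x in eq
... | false = refl
... | true  = contradiction (≤ᵇ⇒≤ n (2 * x) (subst T (sym eq) _)) (<⇒≱ 2x<n)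

orbit-1 : ∀ n t → orbit n 1 t ≡ undecided n t
orbit-1 n zero    = refl
orbit-1 n (suc t) = cong (step n) (orbit-1 n t)

stopCount+undecided : ∀ n t →
  stopCount n (suc t) + undecided n (suc t) ≡ 2 * undecided n t
stopCount+undecided n t with n ≤ᵇ 2 * undecided n t in eq
... | true  = m+[n∸m]≡n (≤ᵇ⇒≤ n _ (subst T (sym eq) _))
... | false = refl

tosses-1 : ∀ n t → tosses n 1 t ≡ num n t + t * undecided n t
tosses-1 n zero    = refl
tosses-1 n (suc t) = begin
  2 * tosses n 1 t + 2 * orbit n 1 t
    ≡⟨ cong₂ (λ a u → 2 * a + 2 * u) (tosses-1 n t) (orbit-1 n t) ⟩
  2 * (num n t + t * u) + 2 * u
    ≡⟨ regroup (num n t) t u ⟩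
  2 * num n t + suc t * (2 * u)
    ≡⟨ cong (λ v → 2 * num n t + suc t * v) (sym (stopCount+undecided n t)) ⟩
  2 * num n t + suc t * (stopCount n (suc t) + undecided n (suc t))
    ≡⟨ distribute (2 * num n t) (suc t) (stopCount n (suc t)) _ ⟩
  num n (suc t) + suc t * undecided n (suc t) ∎
  where
  open ≡-Reasoning
  u : ℕ
  u = undecided n t
  regroup : ∀ a t u → 2 * (a + t * u) + 2 * u ≡ 2 * a + suc t * (2 * u)
  regroup = solve-∀
  distribute : ∀ a t s v → a + t * (s + v) ≡ a + t * s + t * v
  distribute = solve-∀

num≤tosses : ∀ n t → num n t ≤ tosses n 1 t
num≤tosses n t = subst (num n t ≤_) (sym (tosses-1 n t)) (m≤m+n _ _)

step-bounded : ∀ {n x} → x < n → step n x < n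
step-bounded {n} {x} x<n with n ≤? 2 * x
... | yes n≤2x = +-cancelʳ-< n (step n x) n (begin-strict
  step n x + n  ≡⟨ cong (_+ n) (step-≥ {n} {x} n≤2x) ⟩
  2 * x ∸ n + n ≡⟨ m∸n+n≡m n≤2x ⟩
  2 * x         ≡⟨ 2*n≡n+n x ⟩
  x + x         <⟨ +-monoˡ-< x x<n ⟩
  n + x         <⟨ +-monoʳ-< n x<n ⟩
  n + n         ∎)
  where open ≤-Reasoning
... | no n≰2x = subst (_< n) (sym (step-< {n} {x} (≰⇒> n≰2x))) (≰⇒> n≰2x)

orbit-bounded : ∀ {n x} t → x < n → orbit n x t < n
orbit-bounded zero    x<n = x<n
orbit-bounded (suc t) x<n = step-bounded (orbit-bounded t x<n)

orbit-+ : ∀ n x s t → orbit n x (s + t) ≡ orbit n (orbit n x s) t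
orbit-+ n x s zero    = cong (orbit n x) (+-identityʳ s)
orbit-+ n x s (suc t) rewrite +-suc s t = cong (step n) (orbit-+ n x s t)

tosses-+ : ∀ n x s t →
  tosses n x (s + t) ≡ 2 ^ t * tosses n x s + tosses n (orbit n x s) t
tosses-+ n x s zero rewrite +-identityʳ s =
  sym (trans (+-identityʳ _) (*-identityˡ _))
tosses-+ n x s (suc t) rewrite +-suc s t | tosses-+ n x s t | orbit-+ n x s t =
  regroup (2 ^ t) (tosses n x s) (tosses n (orbit n x s) t) (orbit n (orbit n x s) t)
  where
  regroup : ∀ a b c d → 2 * (a * b + c) + 2 * d ≡ 2 * a * b + (2 * c + 2 * d)
  regroup = solve-∀

tosses-superadditive : ∀ n x s t → 2 ^ t * tosses n x s ≤ tosses n x (s + t)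
tosses-superadditive n x s t =
  subst (2 ^ t * tosses n x s ≤_) (sym (tosses-+ n x s t)) (m≤m+n _ _)

tosses-bound-≤ : ∀ {n x a C s t} → s ≤ t →
  a * tosses n x t ≤ 2 ^ t * C → a * tosses n x s ≤ 2 ^ s * C
tosses-bound-≤ {n} {x} {a} {C} {s} {t} s≤t bound =
  *-cancelˡ-≤ (2 ^ e) {{m^n≢0 2 e}} (begin
    2 ^ e * (a * tosses n x s) ≡⟨ x∙yz≈y∙xz (2 ^ e) a _ ⟩
    a * (2 ^ e * tosses n x s) ≤⟨ *-monoʳ-≤ a (tosses-superadditive n x s e) ⟩
    a * tosses n x (s + e)     ≡⟨ cong (λ t → a * tosses n x t) s+e≡t ⟩
    a * tosses n x t           ≤⟨ bound ⟩
    2 ^ t * C                  ≡⟨ cong (λ t → 2 ^ t * C) (sym s+e≡t) ⟩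
    2 ^ (s + e) * C            ≡⟨ cong (_* C) (^-distribˡ-+-* 2 s e) ⟩
    2 ^ s * 2 ^ e * C          ≡⟨ xy∙z≈y∙xz (2 ^ s) (2 ^ e) C ⟩
    2 ^ e * (2 ^ s * C)        ∎)
  where
  open ≤-Reasoning
  e : ℕ
  e = t ∸ s
  s+e≡t : s + e ≡ t
  s+e≡t = m+[n∸m]≡n s≤t

module _ {n : ℕ} (n-odd : ¬ 2 ∣ n) where

  private
    step-complement-mixed : ∀ a b → a + b ≡ n → n ≤ 2 * a → 2 * b < n →
      step n a + step n b ≡ n
    step-complement-mixed a b a+b≡n n≤2a 2b<n = +-cancelʳ-≡ n _ n (begin
      step n a + step n b + n   ≡⟨ cong₂ (λ u v → u + v + n) (step-≥ {n} {a} n≤2a) (step-< {n} {b} 2b<n) ⟩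
      2 * a ∸ n + 2 * b + n     ≡⟨ +-assoc (2 * a ∸ n) (2 * b) n ⟩
      2 * a ∸ n + (2 * b + n)   ≡⟨ cong (2 * a ∸ n +_) (+-comm (2 * b) n) ⟩
      2 * a ∸ n + (n + 2 * b)   ≡⟨ sym (+-assoc (2 * a ∸ n) n (2 * b)) ⟩
      2 * a ∸ n + n + 2 * b     ≡⟨ cong (_+ 2 * b) (m∸n+n≡m n≤2a) ⟩
      2 * a + 2 * b             ≡⟨ sym (*-distribˡ-+ 2 a b) ⟩
      2 * (a + b)               ≡⟨ cong (2 *_) a+b≡n ⟩
      2 * n                     ≡⟨ 2*n≡n+n n ⟩
      n + n                     ∎)
      where open ≡-Reasoning

  step-complement : ∀ a b → a + b ≡ n → step n a + step n b ≡ n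
  step-complement a b a+b≡n with n ≤? 2 * a | n ≤? 2 * b
  ... | yes n≤2a | no n≰2b = step-complement-mixed a b a+b≡n n≤2a (≰⇒> n≰2b)
  ... | no n≰2a | yes n≤2b = trans (+-comm (step n a) (step n b))
    (step-complement-mixed b a (trans (+-comm b a) a+b≡n) n≤2b (≰⇒> n≰2a))
  ... | yes n≤2a | yes n≤2b = contradiction (divides a (trans (sym 2a≡n) (*-comm 2 a))) n-odd
    where
    2a≡n : 2 * a ≡ n
    2a≡n = ≤-antisym (+-cancelʳ-≤ n (2 * a) n (begin
      2 * a + n     ≤⟨ +-monoʳ-≤ (2 * a) n≤2b ⟩
      2 * a + 2 * b ≡⟨ sym (*-distribˡ-+ 2 a b) ⟩
      2 * (a + b)   ≡⟨ cong (2 *_) a+b≡n ⟩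
      2 * n         ≡⟨ 2*n≡n+n n ⟩
      n + n         ∎)) n≤2a
      where open ≤-Reasoning
  ... | no n≰2a | no n≰2b = contradiction 2n<2n (<-irrefl refl)
    where
    2n<2n : 2 * n < 2 * n
    2n<2n = begin-strict
      2 * n         ≡⟨ cong (2 *_) (sym a+b≡n) ⟩
      2 * (a + b)   ≡⟨ *-distribˡ-+ 2 a b ⟩
      2 * a + 2 * b <⟨ +-mono-< (≰⇒> n≰2a) (≰⇒> n≰2b) ⟩
      n + n         ≡⟨ sym (2*n≡n+n n) ⟩
      2 * n         ∎
      where open ≤-Reasoning

  orbit-complement : ∀ a b → a + b ≡ n → ∀ t → orbit n a t + orbit n b t ≡ n
  orbit-complement a b a+b≡n zero    = a+b≡n
  orbit-complement a b a+b≡n (suc t) =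
    step-complement (orbit n a t) (orbit n b t) (orbit-complement a b a+b≡n t)

  tosses-complement : ∀ a b → a + b ≡ n → ∀ t →
    tosses n a t + tosses n b t + 2 * n ≡ 2 * n * 2 ^ t
  tosses-complement a b a+b≡n zero = sym (*-identityʳ (2 * n))
  tosses-complement a b a+b≡n (suc t) = +-cancelʳ-≡ (2 * n) _ _ (begin
    2 * A + 2 * α + (2 * B + 2 * β) + 2 * n + 2 * n ≡⟨ regroup A B α β (2 * n) ⟩
    2 * (A + B + 2 * n) + 2 * (α + β)
      ≡⟨ cong₂ (λ u v → 2 * u + 2 * v) (tosses-complement a b a+b≡n t) (orbit-complement a b a+b≡n t) ⟩
    2 * (2 * n * 2 ^ t) + 2 * n ≡⟨ cong (_+ 2 * n) (x∙yz≈y∙xz 2 (2 * n) (2 ^ t)) ⟩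
    2 * n * 2 ^ suc t + 2 * n ∎)
    where
    open ≡-Reasoning
    A B α β : ℕ
    A = tosses n a t
    B = tosses n b t
    α = orbit n a t
    β = orbit n b t
    regroup : ∀ A B α β m → 2 * A + 2 * α + (2 * B + 2 * β) + m + m ≡ 2 * (A + B + m) + 2 * (α + β)
    regroup = solve-∀

module _ {n : ℕ} where

  private
    shorter : ∀ {y s t} → s ≤ t → 2 ^ t * y < n → 2 ^ s * y < n
    shorter {y} s≤t = ≤-<-trans (*-monoˡ-≤ y (^-monoʳ-≤ 2 s≤t))

  orbit-doubling : ∀ y t → 2 ^ t * y < n → orbit n y t ≡ 2 ^ t * y
  orbit-doubling y zero    _ = sym (*-identityˡ y)
  orbit-doubling y (suc t) 2^[1+t]y<n = begin
    step n (orbit n y t) ≡⟨ cong (step n) (orbit-doubling y t (shorter (n≤1+n t) 2^[1+t]y<n)) ⟩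
    step n (2 ^ t * y)   ≡⟨ step-< {n} {2 ^ t * y} 2*2^ty<n ⟩
    2 * (2 ^ t * y)      ≡⟨ sym (*-assoc 2 (2 ^ t) y) ⟩
    2 ^ suc t * y        ∎
    where
    open ≡-Reasoning
    2*2^ty<n : 2 * (2 ^ t * y) < n
    2*2^ty<n = subst (_< n) (*-assoc 2 (2 ^ t) y) 2^[1+t]y<n

  tosses-doubling : ∀ y t → 2 ^ t * y < n → tosses n y (suc t) ≡ suc t * y * 2 ^ suc t
  tosses-doubling y zero    _ = one-toss y
    where
    one-toss : ∀ y → 2 * 0 + 2 * y ≡ 1 * y * 2 ^ 1
    one-toss = solve-∀
  tosses-doubling y (suc t) 2^[1+t]y<n = begin
    2 * tosses n y (suc t) + 2 * orbit n y (suc t)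
      ≡⟨ cong₂ (λ a b → 2 * a + 2 * b)
               (tosses-doubling y t (shorter (n≤1+n t) 2^[1+t]y<n))
               (orbit-doubling y (suc t) 2^[1+t]y<n) ⟩
    2 * (suc t * y * 2 ^ suc t) + 2 * (2 ^ suc t * y)
      ≡⟨ regroup t y (2 ^ suc t) ⟩
    suc (suc t) * y * 2 ^ suc (suc t) ∎
    where
    open ≡-Reasoning
    regroup : ∀ t y p → 2 * (suc t * y * p) + 2 * (p * y) ≡ suc (suc t) * y * (2 * p)
    regroup = solve-∀

step-2* : ∀ h z → step (2 * h) (2 * z) ≡ 2 * step h z
step-2* h z with h ≤? 2 * z
... | yes h≤2z = begin
  step (2 * h) (2 * z) ≡⟨ step-≥ {2 * h} {2 * z} (*-monoʳ-≤ 2 h≤2z) ⟩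
  2 * (2 * z) ∸ 2 * h  ≡⟨ sym (*-distribˡ-∸ 2 (2 * z) h) ⟩
  2 * (2 * z ∸ h)      ≡⟨ cong (2 *_) (sym (step-≥ {h} {z} h≤2z)) ⟩
  2 * step h z         ∎
  where open ≡-Reasoning
... | no h≰2z = begin
  step (2 * h) (2 * z) ≡⟨ step-< {2 * h} {2 * z} (*-monoʳ-< 2 (≰⇒> h≰2z)) ⟩
  2 * (2 * z)          ≡⟨ cong (2 *_) (sym (step-< {h} {z} (≰⇒> h≰2z))) ⟩
  2 * step h z         ∎
  where open ≡-Reasoning

orbit-2* : ∀ h y t → orbit (2 * h) (2 * y) t ≡ 2 * orbit h y t
orbit-2* h y zero    = refl
orbit-2* h y (suc t) =
  trans (cong (step (2 * h)) (orbit-2* h y t)) (step-2* h (orbit h y t))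

tosses-2* : ∀ h y t → tosses (2 * h) (2 * y) t ≡ 2 * tosses h y t
tosses-2* h y zero    = refl
tosses-2* h y (suc t) rewrite tosses-2* h y t | orbit-2* h y t =
  sym (*-distribˡ-+ 2 (2 * tosses h y t) (2 * orbit h y t))

tosses-2*-1 : ∀ h → 2 ≤ h → ∀ t →
  tosses (2 * h) 1 (suc t) ≡ 2 ^ t * 2 + 2 * tosses h 1 t
tosses-2*-1 h 2≤h t = begin
  tosses (2 * h) 1 (1 + t)                       ≡⟨ tosses-+ (2 * h) 1 1 t ⟩
  2 ^ t * 2 + tosses (2 * h) (step (2 * h) 1) t  ≡⟨ cong (λ y → 2 ^ t * 2 + tosses (2 * h) y t) step-1 ⟩
  2 ^ t * 2 + tosses (2 * h) 2 t                 ≡⟨ cong (2 ^ t * 2 +_) (tosses-2* h 1 t) ⟩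
  2 ^ t * 2 + 2 * tosses h 1 t                   ∎
  where
  open ≡-Reasoning
  step-1 : step (2 * h) 1 ≡ 2
  step-1 = step-< {2 * h} {1} (≤-trans (n≤1+n 3) (*-monoʳ-≤ 2 2≤h))

module _ {n x p : ℕ} (orbit-p : orbit n x p ≡ x) where

  orbit-periodic : ∀ j → orbit n x (p * j) ≡ x
  orbit-periodic zero    = cong (orbit n x) (*-zeroʳ p)
  orbit-periodic (suc j) = begin
    orbit n x (p * suc j)           ≡⟨ cong (orbit n x) (*-suc p j) ⟩
    orbit n x (p + p * j)           ≡⟨ orbit-+ n x p (p * j) ⟩
    orbit n (orbit n x p) (p * j)   ≡⟨ cong (λ y → orbit n y (p * j)) orbit-p ⟩
    orbit n x (p * j)               ≡⟨ orbit-periodic j ⟩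
    x                               ∎
    where open ≡-Reasoning

  tosses-periodic : ∀ {a c} → a * tosses n x p + c ≡ c * 2 ^ p →
    ∀ j → a * tosses n x (p * j) + c ≡ c * 2 ^ (p * j)
  tosses-periodic {a} {c} _ zero rewrite *-zeroʳ p | *-zeroʳ a = sym (*-identityʳ c)
  tosses-periodic {a} {c} one-period (suc j) = begin
    a * tosses n x (p * suc j) + c ≡⟨ cong (λ t → a * tosses n x t + c) (*-suc p j) ⟩
    a * tosses n x (p + p * j) + c ≡⟨ cong (λ t → a * t + c) split ⟩
    a * (q * A + B) + c            ≡⟨ regroup₁ a q A B c ⟩
    q * (a * A) + (a * B + c)      ≡⟨ cong (q * (a * A) +_) (tosses-periodic {a} {c} one-period j) ⟩
    q * (a * A) + c * q            ≡⟨ regroup₂ q (a * A) c ⟩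
    q * (a * A + c)                ≡⟨ cong (q *_) one-period ⟩
    q * (c * 2 ^ p)                ≡⟨ regroup₃ q c (2 ^ p) ⟩
    c * (2 ^ p * q)                ≡⟨ cong (c *_) (sym (^-distribˡ-+-* 2 p (p * j))) ⟩
    c * 2 ^ (p + p * j)            ≡⟨ cong (λ t → c * 2 ^ t) (sym (*-suc p j)) ⟩
    c * 2 ^ (p * suc j)            ∎
    where
    open ≡-Reasoning
    q A B : ℕ
    q = 2 ^ (p * j)
    A = tosses n x p
    B = tosses n x (p * j)
    split : tosses n x (p + p * j) ≡ q * A + B
    split = trans (tosses-+ n x p (p * j)) (cong (λ y → q * A + tosses n y (p * j)) orbit-p)
    regroup₁ : ∀ a q A B c → a * (q * A + B) + c ≡ q * (a * A) + (a * B + c)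
    regroup₁ = solve-∀
    regroup₂ : ∀ q s c → q * s + c * q ≡ q * (s + c)
    regroup₂ = solve-∀
    regroup₃ : ∀ q c P → q * (c * P) ≡ c * (P * q)
    regroup₃ = solve-∀

-- A certificate shows e[n] ≤ cost / scale and
-- cost / scale − 2 ≤ ((n−1)/n) · (p/q) ≤ ((n−1)/n) · log₂ (n−1).
record Certificate (n : ℕ) : Set where
  field
    scale cost p q : ℕ
    .{{scale≢0}}   : NonZero scale
    .{{q≢0}}       : NonZero q
    q≤p            : q ≤ p
    tosses≤        : ∀ t → scale * tosses n 1 t ≤ 2 ^ t * cost
    excess≤        : (cost ∸ 2 * scale) * n * q ≤ scale * (n ∸ 1) * p
    2^p≤           : 2 ^ p ≤ (n ∸ 1) ^ q

certificate⇒eLeBound : ∀ {n} → Certificate n → eLeBound n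
certificate⇒eLeBound {n} c t = ^-cancelʳ-≤ q (begin
  (2 ^ x) ^ q       ≡⟨ ^-*-assoc 2 x q ⟩
  2 ^ (x * q)       ≤⟨ ^-monoʳ-≤ 2 xq≤yp ⟩
  2 ^ (y * p)       ≡⟨ cong (2 ^_) (*-comm y p) ⟩
  2 ^ (p * y)       ≡⟨ sym (^-*-assoc 2 p y) ⟩
  (2 ^ p) ^ y       ≤⟨ ^-monoˡ-≤ y 2^p≤ ⟩
  ((n ∸ 1) ^ q) ^ y ≡⟨ ^-*-assoc (n ∸ 1) q y ⟩
  (n ∸ 1) ^ (q * y) ≡⟨ cong ((n ∸ 1) ^_) (*-comm q y) ⟩
  (n ∸ 1) ^ (y * q) ≡⟨ sym (^-*-assoc (n ∸ 1) y q) ⟩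
  ((n ∸ 1) ^ y) ^ q ∎)
  where
  open Certificate c
  open ≤-Reasoning
  N D x y : ℕ
  N = num n t
  D = 2 ^ t
  x = (N ∸ 2 * D) * n
  y = D * (n ∸ 1)

  excess : scale * (N ∸ 2 * D) ≤ D * (cost ∸ 2 * scale)
  excess = begin
    scale * (N ∸ 2 * D)         ≡⟨ *-distribˡ-∸ scale N (2 * D) ⟩
    scale * N ∸ scale * (2 * D) ≤⟨ ∸-monoˡ-≤ (scale * (2 * D))
                                     (≤-trans (*-monoʳ-≤ scale (num≤tosses n t)) (tosses≤ t)) ⟩
    D * cost ∸ scale * (2 * D)  ≡⟨ cong (D * cost ∸_) (swap scale D) ⟩
    D * cost ∸ D * (2 * scale)  ≡⟨ sym (*-distribˡ-∸ D cost (2 * scale)) ⟩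
    D * (cost ∸ 2 * scale)      ∎
    where
    swap : ∀ a b → a * (2 * b) ≡ b * (2 * a)
    swap = solve-∀

  xq≤yp : x * q ≤ y * p
  xq≤yp = *-cancelˡ-≤ scale (begin
    scale * (x * q)                    ≡⟨ regroup₁ scale (N ∸ 2 * D) n q ⟩
    scale * (N ∸ 2 * D) * (n * q)      ≤⟨ *-monoˡ-≤ (n * q) excess ⟩
    D * (cost ∸ 2 * scale) * (n * q)   ≡⟨ regroup₂ D (cost ∸ 2 * scale) n q ⟩
    D * ((cost ∸ 2 * scale) * n * q)   ≤⟨ *-monoʳ-≤ D excess≤ ⟩
    D * (scale * (n ∸ 1) * p)          ≡⟨ regroup₃ D scale (n ∸ 1) p ⟩
    scale * (y * p)                    ∎)
    where
    regroup₁ : ∀ a b c d → a * (b * c * d) ≡ a * b * (c * d)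
    regroup₁ = solve-∀
    regroup₂ : ∀ a b c d → a * b * (c * d) ≡ a * (b * c * d)
    regroup₂ = solve-∀
    regroup₃ : ∀ a b c d → a * (b * c * d) ≡ b * (a * c * d)
    regroup₃ = solve-∀

-- Φ u bounds scale times the tosses still to come from u undecided sequences,
-- each counted with weight one; descent says this bound survives one toss.
potential-bound : ∀ {n} scale cost (Φ : ℕ → ℕ) → 1 < n →
  (∀ {u} → u < n → Φ (step n u) + 2 * scale * u ≤ 2 * Φ u) → Φ 1 ≤ cost →
  ∀ t → scale * tosses n 1 t + Φ (orbit n 1 t) ≤ 2 ^ t * cost
potential-bound {n} scale cost Φ 1<n descent Φ1≤cost zero =
  subst₂ _≤_ (cong (_+ Φ 1) (sym (*-zeroʳ scale))) (sym (*-identityˡ cost)) Φ1≤cost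
potential-bound {n} scale cost Φ 1<n descent Φ1≤cost (suc t) = begin
  scale * (2 * a + 2 * u) + Φ (step n u)   ≡⟨ regroup scale a u (Φ (step n u)) ⟩
  2 * (scale * a) + (Φ (step n u) + 2 * scale * u)
    ≤⟨ +-monoʳ-≤ (2 * (scale * a)) (descent (orbit-bounded t 1<n)) ⟩
  2 * (scale * a) + 2 * Φ u                ≡⟨ sym (*-distribˡ-+ 2 (scale * a) (Φ u)) ⟩
  2 * (scale * a + Φ u)                    ≤⟨ *-monoʳ-≤ 2 (potential-bound scale cost Φ 1<n descent Φ1≤cost t) ⟩
  2 * (2 ^ t * cost)                       ≡⟨ sym (*-assoc 2 (2 ^ t) cost) ⟩
  2 ^ suc t * cost                         ∎
  where
  open ≤-Reasoning
  a u : ℕ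
  a = tosses n 1 t
  u = orbit n 1 t
  regroup : ∀ s a u f → s * (2 * a + 2 * u) + f ≡ 2 * (s * a) + (f + 2 * s * u)
  regroup = solve-∀

-- Small n

record Entry : Set where
  constructor entry
  field
    scale cost p q : ℕ
    potential      : List ℕ

at : {A : Set} → A → List A → ℕ → A
at default xs i = fromMaybe default (head (drop i xs))

Valid : ℕ → Entry → Set
Valid n (entry s c p q Φs) =
  1 < n × 0 < s × 0 < q × q ≤ p ×
  (∀ {u} → u < n → Φ (step n u) + 2 * s * u ≤ 2 * Φ u) × Φ 1 ≤ c ×
  (c ∸ 2 * s) * n * q ≤ s * (n ∸ 1) * p × 2 ^ p ≤ (n ∸ 1) ^ q
  where Φ = at 0 Φs

valid? : ∀ n e → Dec (Valid n e)
valid? n (entry s c p q Φs) =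
  1 <? n ×-dec 0 <? s ×-dec 0 <? q ×-dec q ≤? p ×-dec
  allUpTo? (λ u → Φ (step n u) + 2 * s * u ≤? 2 * Φ u) n ×-dec Φ 1 ≤? c ×-dec
  (c ∸ 2 * s) * n * q ≤? s * (n ∸ 1) * p ×-dec 2 ^ p ≤? (n ∸ 1) ^ q
  where Φ = at 0 Φs

valid⇒certificate : ∀ n e → Valid n e → Certificate n
valid⇒certificate n (entry s c p q Φs) (1<n , 0<s , 0<q , q≤p , descent , Φ1≤c , excess , power) =
  record
    { scale = s ; cost = c ; p = p ; q = q
    ; scale≢0 = >-nonZero 0<s ; q≢0 = >-nonZero 0<q
    ; q≤p = q≤p
    ; tosses≤ = λ t → ≤-trans (m≤m+n _ _) (potential-bound s c (at 0 Φs) 1<n descent Φ1≤c t)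
    ; excess≤ = excess
    ; 2^p≤ = power
    }

-- Row i certifies n = i + 3 and lists scale, cost, p, q, then Φ 0, …, Φ (n − 1).
table : List Entry
table =
  entry 3 8 1 1 (0 ∷ 8 ∷ 10 ∷ [])
  ∷ entry 2 5 1 1 (1 ∷ 5 ∷ 5 ∷ 9 ∷ [])
  ∷ entry 5 18 2 1 (0 ∷ 18 ∷ 26 ∷ 24 ∷ 32 ∷ [])
  ∷ entry 8 31 9 4 (1 ∷ 31 ∷ 44 ∷ 25 ∷ 55 ∷ 68 ∷ [])
  ∷ entry 2 8 5 2 (1 ∷ 8 ∷ 11 ∷ 18 ∷ 13 ∷ 20 ∷ 23 ∷ [])
  ∷ entry 2 7 2 1 (1 ∷ 7 ∷ 9 ∷ 15 ∷ 9 ∷ 15 ∷ 17 ∷ 23 ∷ [])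
  ∷ entry 9 42 3 1 (0 ∷ 42 ∷ 66 ∷ 162 ∷ 96 ∷ 66 ∷ 162 ∷ 96 ∷ 120 ∷ [])
  ∷ entry 8 38 19 6 (1 ∷ 38 ∷ 59 ∷ 64 ∷ 85 ∷ 41 ∷ 78 ∷ 99 ∷ 104 ∷ 125 ∷ [])
  ∷ entry 16 79 13 4 (1 ∷ 79 ∷ 125 ∷ 117 ∷ 184 ∷ 219 ∷ 136 ∷ 171 ∷ 238 ∷ 230 ∷ 276 ∷ [])
  ∷ entry 4 20 10 3 (1 ∷ 20 ∷ 31 ∷ 25 ∷ 44 ∷ 55 ∷ 25 ∷ 44 ∷ 55 ∷ 49 ∷ 68 ∷ 79 ∷ [])
  ∷ entry 4 20 7 2 (1 ∷ 20 ∷ 31 ∷ 47 ∷ 45 ∷ 51 ∷ 68 ∷ 39 ∷ 56 ∷ 62 ∷ 60 ∷ 76 ∷ 87 ∷ [])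
  ∷ entry 2 10 7 2 (1 ∷ 10 ∷ 15 ∷ 24 ∷ 21 ∷ 30 ∷ 35 ∷ 15 ∷ 24 ∷ 29 ∷ 38 ∷ 35 ∷ 44 ∷ 49 ∷ [])
  ∷ entry 2 10 7 2 (1 ∷ 10 ∷ 15 ∷ 23 ∷ 20 ∷ 28 ∷ 33 ∷ 41 ∷ 22 ∷ 30 ∷ 35 ∷ 43 ∷ 40 ∷ 48 ∷ 53 ∷ [])
  ∷ entry 2 9 3 1 (1 ∷ 9 ∷ 13 ∷ 21 ∷ 17 ∷ 25 ∷ 29 ∷ 37 ∷ 17 ∷ 25 ∷ 29 ∷ 37 ∷ 33 ∷ 41 ∷ 45 ∷ 53 ∷ [])
  ∷ entry 17 98 4 1 (0 ∷ 98 ∷ 162 ∷ 578 ∷ 256 ∷ 578 ∷ 578 ∷ 578 ∷ 376 ∷ 202 ∷ 578 ∷ 578 ∷ 578 ∷ 322 ∷ 578 ∷ 416 ∷ 480 ∷ [])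
  ∷ entry 16 92 4 1 (1 ∷ 92 ∷ 151 ∷ 177 ∷ 236 ∷ 199 ∷ 257 ∷ 284 ∷ 343 ∷ 145 ∷ 236 ∷ 295 ∷ 321 ∷ 380 ∷ 343 ∷ 401 ∷ 428 ∷ 487 ∷ [])
  ∷ entry 8 47 25 6 (1 ∷ 47 ∷ 77 ∷ 85 ∷ 121 ∷ 93 ∷ 120 ∷ 164 ∷ 176 ∷ 203 ∷ 104 ∷ 131 ∷ 143 ∷ 187 ∷ 214 ∷ 186 ∷ 222 ∷ 230 ∷ 260 ∷ [])
  ∷ entry 8 46 4 1 (1 ∷ 46 ∷ 75 ∷ 88 ∷ 117 ∷ 81 ∷ 126 ∷ 155 ∷ 168 ∷ 197 ∷ 81 ∷ 126 ∷ 155 ∷ 168 ∷ 197 ∷ 161 ∷ 206 ∷ 235 ∷ 248 ∷ 277 ∷ [])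
  ∷ entry 2 12 17 4 (1 ∷ 12 ∷ 19 ∷ 22 ∷ 29 ∷ 40 ∷ 31 ∷ 39 ∷ 40 ∷ 51 ∷ 58 ∷ 29 ∷ 36 ∷ 47 ∷ 48 ∷ 56 ∷ 47 ∷ 58 ∷ 65 ∷ 68 ∷ 75 ∷ [])
  ∷ entry 8 48 13 3 (1 ∷ 48 ∷ 79 ∷ 83 ∷ 125 ∷ 150 ∷ 117 ∷ 142 ∷ 184 ∷ 188 ∷ 219 ∷ 89 ∷ 136 ∷ 167 ∷ 171 ∷ 213 ∷ 238 ∷ 205 ∷ 230 ∷ 272 ∷ 276 ∷ 307 ∷ [])
  ∷ entry 4 24 13 3 (1 ∷ 24 ∷ 39 ∷ 40 ∷ 61 ∷ 78 ∷ 55 ∷ 77 ∷ 88 ∷ 91 ∷ 114 ∷ 126 ∷ 61 ∷ 73 ∷ 96 ∷ 99 ∷ 110 ∷ 132 ∷ 109 ∷ 126 ∷ 147 ∷ 148 ∷ 163 ∷ [])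
  ∷ entry 4 24 9 2 (1 ∷ 24 ∷ 39 ∷ 37 ∷ 60 ∷ 75 ∷ 49 ∷ 72 ∷ 87 ∷ 85 ∷ 108 ∷ 123 ∷ 49 ∷ 72 ∷ 87 ∷ 85 ∷ 108 ∷ 123 ∷ 97 ∷ 120 ∷ 135 ∷ 133 ∷ 156 ∷ 171 ∷ [])
  ∷ entry 4 24 9 2 (1 ∷ 24 ∷ 38 ∷ 60 ∷ 58 ∷ 73 ∷ 94 ∷ 72 ∷ 83 ∷ 102 ∷ 105 ∷ 116 ∷ 138 ∷ 65 ∷ 87 ∷ 97 ∷ 101 ∷ 120 ∷ 131 ∷ 109 ∷ 129 ∷ 145 ∷ 143 ∷ 165 ∷ 179 ∷ [])
  ∷ entry 4 24 9 2 (1 ∷ 24 ∷ 39 ∷ 59 ∷ 61 ∷ 71 ∷ 92 ∷ 67 ∷ 88 ∷ 98 ∷ 100 ∷ 120 ∷ 135 ∷ 53 ∷ 76 ∷ 91 ∷ 111 ∷ 113 ∷ 123 ∷ 144 ∷ 119 ∷ 140 ∷ 150 ∷ 152 ∷ 172 ∷ 187 ∷ [])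
  ∷ entry 4 24 9 2 (1 ∷ 24 ∷ 38 ∷ 57 ∷ 59 ∷ 80 ∷ 89 ∷ 63 ∷ 85 ∷ 97 ∷ 119 ∷ 114 ∷ 129 ∷ 150 ∷ 69 ∷ 89 ∷ 105 ∷ 100 ∷ 121 ∷ 134 ∷ 156 ∷ 129 ∷ 139 ∷ 160 ∷ 161 ∷ 181 ∷ 195 ∷ [])
  ∷ entry 2 12 9 2 (1 ∷ 12 ∷ 19 ∷ 30 ∷ 29 ∷ 40 ∷ 47 ∷ 29 ∷ 40 ∷ 47 ∷ 58 ∷ 57 ∷ 68 ∷ 75 ∷ 29 ∷ 40 ∷ 47 ∷ 58 ∷ 57 ∷ 68 ∷ 75 ∷ 57 ∷ 68 ∷ 75 ∷ 86 ∷ 85 ∷ 96 ∷ 103 ∷ [])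
  ∷ entry 2 12 9 2 (1 ∷ 12 ∷ 19 ∷ 29 ∷ 29 ∷ 38 ∷ 45 ∷ 56 ∷ 40 ∷ 51 ∷ 55 ∷ 54 ∷ 65 ∷ 72 ∷ 82 ∷ 37 ∷ 47 ∷ 54 ∷ 65 ∷ 64 ∷ 68 ∷ 79 ∷ 63 ∷ 74 ∷ 81 ∷ 90 ∷ 90 ∷ 100 ∷ 107 ∷ [])
  ∷ entry 2 12 9 2 (1 ∷ 12 ∷ 19 ∷ 29 ∷ 28 ∷ 38 ∷ 45 ∷ 55 ∷ 38 ∷ 48 ∷ 55 ∷ 65 ∷ 64 ∷ 74 ∷ 81 ∷ 31 ∷ 42 ∷ 49 ∷ 59 ∷ 58 ∷ 68 ∷ 75 ∷ 85 ∷ 68 ∷ 78 ∷ 85 ∷ 95 ∷ 94 ∷ 104 ∷ 111 ∷ [])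
  ∷ entry 2 12 9 2 (1 ∷ 12 ∷ 18 ∷ 28 ∷ 27 ∷ 37 ∷ 43 ∷ 54 ∷ 36 ∷ 46 ∷ 53 ∷ 63 ∷ 61 ∷ 72 ∷ 78 ∷ 88 ∷ 39 ∷ 49 ∷ 55 ∷ 66 ∷ 64 ∷ 74 ∷ 81 ∷ 91 ∷ 73 ∷ 84 ∷ 90 ∷ 100 ∷ 99 ∷ 109 ∷ 115 ∷ [])
  ∷ entry 2 11 4 1 (1 ∷ 11 ∷ 17 ∷ 27 ∷ 25 ∷ 35 ∷ 41 ∷ 51 ∷ 33 ∷ 43 ∷ 49 ∷ 59 ∷ 57 ∷ 67 ∷ 73 ∷ 83 ∷ 33 ∷ 43 ∷ 49 ∷ 59 ∷ 57 ∷ 67 ∷ 73 ∷ 83 ∷ 65 ∷ 75 ∷ 81 ∷ 91 ∷ 89 ∷ 99 ∷ 105 ∷ 115 ∷ [])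
  ∷ []

tableEntry : ℕ → Entry
tableEntry n = at (entry 0 0 0 0 []) table (n ∸ 3)

table-valid : ∀ {n} → n < 33 → 3 ≤ n → Valid n (tableEntry n)
table-valid = toWitness {a? = allUpTo? (λ n → 3 ≤? n →-dec valid? n (tableEntry n)) 33} _

-- Even n

-- e[2h] = 1 + e[h]: the first toss only halves the problem.
double-certificate : ∀ h → 2 ≤ h → Certificate h → Certificate (2 * h)
double-certificate h@(suc h-1) 2≤h c = record
  { scale = scale ; cost = cost + scale ; p = p + q ; q = q
  ; q≤p = m≤n+m q p
  ; tosses≤ = tosses≤′
  ; excess≤ = excess≤′
  ; 2^p≤ = 2^p≤′
  }
  where
  open Certificate c

  tosses≤′ : ∀ t → scale * tosses (2 * h) 1 t ≤ 2 ^ t * (cost + scale)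
  tosses≤′ zero    = subst (_≤ 1 * (cost + scale)) (sym (*-zeroʳ scale)) z≤n
  tosses≤′ (suc t) = begin
    scale * tosses (2 * h) 1 (suc t)                 ≡⟨ cong (scale *_) (tosses-2*-1 h 2≤h t) ⟩
    scale * (2 ^ t * 2 + 2 * tosses h 1 t)           ≡⟨ regroup₁ scale (2 ^ t) (tosses h 1 t) ⟩
    2 * (2 ^ t * scale) + 2 * (scale * tosses h 1 t) ≤⟨ +-monoʳ-≤ (2 * (2 ^ t * scale)) (*-monoʳ-≤ 2 (tosses≤ t)) ⟩
    2 * (2 ^ t * scale) + 2 * (2 ^ t * cost)         ≡⟨ regroup₂ (2 ^ t) scale cost ⟩
    2 ^ suc t * (cost + scale)                       ∎
    where
    open ≤-Reasoning
    regroup₁ : ∀ s x a → s * (x * 2 + 2 * a) ≡ 2 * (x * s) + 2 * (s * a)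
    regroup₁ = solve-∀
    regroup₂ : ∀ x s c → 2 * (x * s) + 2 * (x * c) ≡ 2 * x * (c + s)
    regroup₂ = solve-∀

  e : ℕ
  e = cost ∸ 2 * scale

  shifted-excess : cost + scale ∸ 2 * scale ≤ e + scale
  shifted-excess = begin
    cost + scale ∸ 2 * scale             ≤⟨ ∸-monoˡ-≤ (2 * scale) (+-monoˡ-≤ scale (m≤n+m∸n cost (2 * scale))) ⟩
    2 * scale + e + scale ∸ 2 * scale    ≡⟨ cong (_∸ 2 * scale) (+-assoc (2 * scale) e scale) ⟩
    2 * scale + (e + scale) ∸ 2 * scale  ≡⟨ m+n∸m≡n (2 * scale) (e + scale) ⟩
    e + scale                            ∎
    where open ≤-Reasoning

  excess≤′ : (cost + scale ∸ 2 * scale) * (2 * h) * q ≤ scale * (2 * h ∸ 1) * (p + q)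
  excess≤′ = begin
    (cost + scale ∸ 2 * scale) * (2 * h) * q  ≤⟨ *-monoˡ-≤ q (*-monoˡ-≤ (2 * h) shifted-excess) ⟩
    (e + scale) * (2 * h) * q                 ≡⟨ regroup₁ e scale h q ⟩
    2 * (e * h * q) + 2 * scale * h * q       ≤⟨ +-monoˡ-≤ (2 * scale * h * q) (*-monoʳ-≤ 2 excess≤) ⟩
    2 * (scale * h-1 * p) + 2 * scale * h * q ≤⟨ m≤m+n _ (scale * (p ∸ q)) ⟩
    2 * (scale * h-1 * p) + 2 * scale * h * q + scale * (p ∸ q)
      ≡⟨ regroup₂ scale h-1 p q (p ∸ q) (m∸n+n≡m q≤p) ⟩
    scale * (2 * h ∸ 1) * (p + q)             ∎
    where
    open ≤-Reasoning
    regroup₁ : ∀ e s h q → (e + s) * (2 * h) * q ≡ 2 * (e * h * q) + 2 * s * h * q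
    regroup₁ = solve-∀
    regroup₂ : ∀ s h-1 p q d → d + q ≡ p →
      2 * (s * h-1 * p) + 2 * s * suc h-1 * q + s * d ≡ s * (2 * suc h-1 ∸ 1) * (p + q)
    regroup₂ s h-1 p q d refl = identity s h-1 q d
      where
      identity : ∀ s h-1 q d →
        2 * (s * h-1 * (d + q)) + 2 * s * suc h-1 * q + s * d ≡ s * (h-1 + suc (h-1 + 0)) * (d + q + q)
      identity = solve-∀

  2^p≤′ : 2 ^ (p + q) ≤ (2 * h ∸ 1) ^ q
  2^p≤′ = begin
    2 ^ (p + q)         ≡⟨ ^-distribˡ-+-* 2 p q ⟩
    2 ^ p * 2 ^ q       ≤⟨ *-monoˡ-≤ (2 ^ q) 2^p≤ ⟩
    h-1 ^ q * 2 ^ q     ≡⟨ sym (^-distribʳ-* h-1 2 q) ⟩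
    (h-1 * 2) ^ q       ≡⟨ cong (_^ q) (*-comm h-1 2) ⟩
    (2 * h-1) ^ q       ≤⟨ ^-monoˡ-≤ q (n≤1+n _) ⟩
    suc (2 * h-1) ^ q   ≡⟨ cong (λ m → (m ∸ 1) ^ q) (sym (*-suc 2 h-1)) ⟩
    (2 * h ∸ 1) ^ q     ∎
    where open ≤-Reasoning

-- Odd n

module TwoPowerPlus (m-1 r : ℕ) (0<r : 0 < r) where

  m x n : ℕ
  m = suc m-1
  x = 2 ^ m
  n = x + r

  x<n : x < n
  x<n = subst (_≤ n) (+-comm x 1) (+-monoʳ-≤ x 0<r)

  orbit-m : orbit n 1 m ≡ x
  orbit-m = trans (orbit-doubling 1 m (subst (_< n) (sym (*-identityʳ x)) x<n)) (*-identityʳ x)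

  tosses-m : tosses n 1 m ≡ m * x
  tosses-m = trans (tosses-doubling 1 m-1 2^m-1<n) (cong (_* x) (*-identityʳ m))
    where
    2^m-1<n : 2 ^ m-1 * 1 < n
    2^m-1<n = ≤-<-trans (*-monoˡ-≤ 1 (^-monoʳ-≤ 2 (n≤1+n m-1))) (subst (_< n) (sym (*-identityʳ x)) x<n)

  -- For odd n the orbit of 1, having reached 2^m, is complementary to the orbit
  -- of r; and as 2^(k+1)·r < n, none of the r sequences stops before toss k + 2.
  module _ (n-odd : ¬ 2 ∣ n) (k : ℕ) (2^[1+k]r<n : 2 ^ suc k * r < n) where

    residue-tosses : ∀ i → (2 + k) * r * 2 ^ (2 + k + i) ≤ tosses n r (2 + k + i)
    residue-tosses i = begin
      (2 + k) * r * 2 ^ (2 + k + i)          ≡⟨ cong ((2 + k) * r *_) (^-distribˡ-+-* 2 (2 + k) i) ⟩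
      (2 + k) * r * (2 ^ (2 + k) * 2 ^ i)    ≡⟨ regroup ((2 + k) * r) (2 ^ (2 + k)) (2 ^ i) ⟩
      2 ^ i * ((2 + k) * r * 2 ^ (2 + k))    ≡⟨ cong (2 ^ i *_) (sym (tosses-doubling r (suc k) 2^[1+k]r<n)) ⟩
      2 ^ i * tosses n r (2 + k)             ≤⟨ tosses-superadditive n r (2 + k) i ⟩
      tosses n r (2 + k + i)                 ∎
      where
      open ≤-Reasoning
      regroup : ∀ a b c → a * (b * c) ≡ c * (a * b)
      regroup = solve-∀

    tosses-after : ∀ j → (2 + k) * r * 2 ^ j ≤ tosses n r j →
      tosses n 1 (m + j) + 2 ^ j * (k * r) ≤ 2 ^ j * ((2 + m) * x)
    tosses-after j residue = +-cancelʳ-≤ (2 ^ j * (2 * r)) _ _ (begin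
      tosses n 1 (m + j) + 2 ^ j * (k * r) + 2 ^ j * (2 * r)
        ≡⟨ cong (λ a → a + 2 ^ j * (k * r) + 2 ^ j * (2 * r)) split ⟩
      2 ^ j * (m * x) + tosses n x j + 2 ^ j * (k * r) + 2 ^ j * (2 * r)
        ≡⟨ regroup₁ (2 ^ j) (m * x) (tosses n x j) k r ⟩
      2 ^ j * (m * x) + tosses n x j + (2 + k) * r * 2 ^ j
        ≤⟨ +-monoʳ-≤ (2 ^ j * (m * x) + tosses n x j) residue ⟩
      2 ^ j * (m * x) + tosses n x j + tosses n r j
        ≤⟨ m≤m+n _ (2 * n) ⟩
      2 ^ j * (m * x) + tosses n x j + tosses n r j + 2 * n
        ≡⟨ regroup₂ (2 ^ j * (m * x)) (tosses n x j) (tosses n r j) (2 * n) ⟩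
      2 ^ j * (m * x) + (tosses n x j + tosses n r j + 2 * n)
        ≡⟨ cong (2 ^ j * (m * x) +_) (tosses-complement n-odd x r refl j) ⟩
      2 ^ j * (m * x) + 2 * n * 2 ^ j
        ≡⟨ regroup₃ (2 ^ j) m x r ⟩
      2 ^ j * ((2 + m) * x) + 2 ^ j * (2 * r) ∎)
      where
      open ≤-Reasoning
      split : tosses n 1 (m + j) ≡ 2 ^ j * (m * x) + tosses n x j
      split = trans (tosses-+ n 1 m j)
                    (cong₂ (λ a y → 2 ^ j * a + tosses n y j) tosses-m orbit-m)
      regroup₁ : ∀ p a b k r → p * a + b + p * (k * r) + p * (2 * r) ≡ p * a + b + (2 + k) * r * p
      regroup₁ = solve-∀
      regroup₂ : ∀ a b c d → a + b + c + d ≡ a + (b + c + d)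
      regroup₂ = solve-∀
      regroup₃ : ∀ p m x r → p * (m * x) + 2 * (x + r) * p ≡ p * ((2 + m) * x) + p * (2 * r)
      regroup₃ = solve-∀

    cost : ℕ
    cost = (2 + m) * x ∸ k * r

    tosses≤ : ∀ t → x * tosses n 1 t ≤ 2 ^ t * cost
    tosses≤ t = tosses-bound-≤ {n} {1} {x} (≤-trans (m≤n+m t (2 + k)) (m≤n+m _ m)) (begin
      x * tosses n 1 (m + j)
        ≤⟨ *-monoʳ-≤ x (m+n≤o⇒m≤o∸n _ (tosses-after j (residue-tosses t))) ⟩
      x * (2 ^ j * ((2 + m) * x) ∸ 2 ^ j * (k * r)) ≡⟨ cong (x *_) (sym (*-distribˡ-∸ (2 ^ j) _ _)) ⟩
      x * (2 ^ j * cost)                            ≡⟨ sym (*-assoc x (2 ^ j) cost) ⟩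
      x * 2 ^ j * cost                              ≡⟨ cong (_* cost) (sym (^-distribˡ-+-* 2 m j)) ⟩
      2 ^ (m + j) * cost                            ∎)
      where
      open ≤-Reasoning
      j : ℕ
      j = 2 + k + t

    cost∸2x : cost ∸ 2 * x ≡ m * x ∸ k * r
    cost∸2x = begin
      (2 + m) * x ∸ k * r ∸ 2 * x     ≡⟨ ∸-+-assoc ((2 + m) * x) (k * r) (2 * x) ⟩
      (2 + m) * x ∸ (k * r + 2 * x)   ≡⟨ cong₂ _∸_ (*-distribʳ-+ x 2 m) (+-comm (k * r) (2 * x)) ⟩
      2 * x + m * x ∸ (2 * x + k * r) ≡⟨ [m+n]∸[m+o]≡n∸o (2 * x) (m * x) (k * r) ⟩
      m * x ∸ k * r                   ∎
      where open ≡-Reasoning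

    excess≤ : ∀ d → x * (4 * m + d) ≤ n * (4 * (k * r) + d * x) →
      (cost ∸ 2 * x) * n * 4 ≤ x * (n ∸ 1) * (4 * m + d)
    excess≤ d key rewrite cost∸2x with k * r ≤? m * x
    ... | no kr≰mx = subst (λ e → e * n * 4 ≤ x * (n ∸ 1) * (4 * m + d))
                           (sym (m≤n⇒m∸n≡0 (<⇒≤ (≰⇒> kr≰mx)))) z≤n
    ... | yes kr≤mx = +-cancelʳ-≤ (n * (4 * (k * r) + d * x)) _ _ (begin
      (m * x ∸ k * r) * n * 4 + n * (4 * (k * r) + d * x)
        ≡⟨ regroup₁ (m * x ∸ k * r) n (k * r) d x ⟩
      n * (4 * (m * x ∸ k * r + k * r) + d * x)
        ≡⟨ cong (λ a → n * (4 * a + d * x)) (m∸n+n≡m kr≤mx) ⟩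
      n * (4 * (m * x) + d * x)
        ≡⟨ cong (λ a → a * (4 * (m * x) + d * x)) (sym 1+[n∸1]≡n) ⟩
      suc (n ∸ 1) * (4 * (m * x) + d * x)
        ≡⟨ regroup₂ (n ∸ 1) x m d ⟩
      x * (n ∸ 1) * (4 * m + d) + x * (4 * m + d)
        ≤⟨ +-monoʳ-≤ (x * (n ∸ 1) * (4 * m + d)) key ⟩
      x * (n ∸ 1) * (4 * m + d) + n * (4 * (k * r) + d * x) ∎)
      where
      open ≤-Reasoning
      1+[n∸1]≡n : suc (n ∸ 1) ≡ n
      1+[n∸1]≡n = m+[n∸m]≡n (≤-trans 0<r (m≤n+m r x))
      regroup₁ : ∀ z n w d x → z * n * 4 + n * (4 * w + d * x) ≡ n * (4 * (z + w) + d * x)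
      regroup₁ = solve-∀
      regroup₂ : ∀ n-1 x m d → suc n-1 * (4 * (m * x) + d * x) ≡ x * n-1 * (4 * m + d) + x * (4 * m + d)
      regroup₂ = solve-∀

    certificate : ∀ d → x * (4 * m + d) ≤ n * (4 * (k * r) + d * x) →
      2 ^ (4 * m + d) ≤ (n ∸ 1) ^ 4 → Certificate n
    certificate d key 2^p≤ = record
      { scale = x ; cost = cost ; p = 4 * m + d ; q = 4
      ; scale≢0 = m^n≢0 2 m
      ; q≤p = ≤-trans (*-monoʳ-≤ 4 (s≤s z≤n)) (m≤m+n (4 * m) d)
      ; tosses≤ = tosses≤
      ; excess≤ = excess≤ d key
      ; 2^p≤ = 2^p≤
      }

module _ (m-1 r : ℕ) (4≤m-1 : 4 ≤ m-1) (2≤r : 2 ≤ r) (r<x : r < 2 ^ suc m-1)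
         (n-odd : ¬ 2 ∣ (2 ^ suc m-1 + r)) where

  open TwoPowerPlus m-1 r (≤-trans (s≤s z≤n) 2≤r)

  x≤n∸1 : x ≤ n ∸ 1
  x≤n∸1 = m+n≤o⇒m≤o∸n x (subst (_≤ n) (+-comm 1 x) x<n)

  4m+1≤x : 4 * m + 1 ≤ x
  4m+1≤x = subst (4 * m + 1 ≤_) (*-identityˡ x)
    (linear≤exponential 4 1 1 (≤ᵇ⇒≤ 21 32 _) (≤ᵇ⇒≤ 4 32 _) (s≤s 4≤m-1))

  -- When r ≥ x/4 + 1, n − 1 ≥ 5x/4 gives p/q = m + 1/4 ≤ log₂ (n − 1), and
  -- 4m + 1 ≤ n absorbs the factor (n−1)/n.
  wide-residue-certificate : x + 4 ≤ 4 * r → Certificate n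
  wide-residue-certificate x+4≤4r = certificate n-odd 0 2r<n 1 key 2^p≤
    where
    open ≤-Reasoning
    2r<n : 2 ^ 1 * r < n
    2r<n = begin-strict
      2 ^ 1 * r ≡⟨ 2*n≡n+n r ⟩
      r + r     <⟨ +-monoˡ-< r r<x ⟩
      n         ∎
    key : x * (4 * m + 1) ≤ n * (4 * (0 * r) + 1 * x)
    key = begin
      x * (4 * m + 1)           ≤⟨ *-monoʳ-≤ x (≤-trans 4m+1≤x (m≤m+n x r)) ⟩
      x * n                     ≡⟨ regroup x n ⟩
      n * (4 * (0 * r) + 1 * x) ∎
      where
      regroup : ∀ x n → x * n ≡ n * (4 * (0 * r) + 1 * x)
      regroup = solve-∀
    5x≤4[n∸1] : 5 * x ≤ 4 * (n ∸ 1)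
    5x≤4[n∸1] = +-cancelʳ-≤ 4 (5 * x) (4 * (n ∸ 1)) (begin
      5 * x + 4         ≡⟨ regroup₁ x ⟩
      4 * x + (x + 4)   ≤⟨ +-monoʳ-≤ (4 * x) x+4≤4r ⟩
      4 * x + 4 * r     ≡⟨ sym (*-distribˡ-+ 4 x r) ⟩
      4 * n             ≡⟨ cong (4 *_) (sym (m∸n+n≡m (≤-trans (s≤s z≤n) x<n))) ⟩
      4 * (n ∸ 1 + 1)   ≡⟨ regroup₂ (n ∸ 1) ⟩
      4 * (n ∸ 1) + 4   ∎)
      where
      regroup₁ : ∀ x → 5 * x + 4 ≡ 4 * x + (x + 4)
      regroup₁ = solve-∀
      regroup₂ : ∀ y → 4 * (y + 1) ≡ 4 * y + 4
      regroup₂ = solve-∀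
    2^p≤ : 2 ^ (4 * m + 1) ≤ (n ∸ 1) ^ 4
    2^p≤ = *-cancelˡ-≤ 256 (begin
      256 * 2 ^ (4 * m + 1)  ≡⟨ cong (λ e → 256 * 2 ^ (e + 1)) (*-comm 4 m) ⟩
      256 * 2 ^ (m * 4 + 1)  ≡⟨ cong (256 *_) (^-distribˡ-+-* 2 (m * 4) 1) ⟩
      256 * (2 ^ (m * 4) * 2) ≡⟨ cong (λ p → 256 * (p * 2)) (sym (^-*-assoc 2 m 4)) ⟩
      256 * (x ^ 4 * 2)      ≡⟨ cong (256 *_) (*-comm (x ^ 4) 2) ⟩
      256 * (2 * x ^ 4)      ≡⟨ sym (*-assoc 256 2 (x ^ 4)) ⟩
      512 * x ^ 4            ≤⟨ *-monoˡ-≤ (x ^ 4) (≤ᵇ⇒≤ 512 625 _) ⟩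
      625 * x ^ 4            ≡⟨ sym (^-distribʳ-* 5 x 4) ⟩
      (5 * x) ^ 4            ≤⟨ ^-monoˡ-≤ 4 5x≤4[n∸1] ⟩
      (4 * (n ∸ 1)) ^ 4      ≡⟨ ^-distribʳ-* 4 (n ∸ 1) 4 ⟩
      256 * (n ∸ 1) ^ 4      ∎)

  -- Once k·r ≥ m, the saving k·r/x pays for the factor (n−1)/n, and p/q = m
  -- is below log₂ (n − 1).
  narrow-residue-certificate : ∀ k → 2 ^ suc k * r < n → m ≤ k * r → Certificate n
  narrow-residue-certificate k 2^[1+k]r<n m≤kr = certificate n-odd k 2^[1+k]r<n 0 key 2^p≤
    where
    open ≤-Reasoning
    key : x * (4 * m + 0) ≤ n * (4 * (k * r) + 0 * x)
    key = *-mono-≤ (m≤m+n x r) (+-monoˡ-≤ 0 (*-monoʳ-≤ 4 m≤kr))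
    2^p≤ : 2 ^ (4 * m + 0) ≤ (n ∸ 1) ^ 4
    2^p≤ = begin
      2 ^ (4 * m + 0) ≡⟨ cong (2 ^_) (trans (+-identityʳ (4 * m)) (*-comm 4 m)) ⟩
      2 ^ (m * 4)     ≡⟨ sym (^-*-assoc 2 m 4) ⟩
      x ^ 4           ≤⟨ ^-monoˡ-≤ 4 x≤n∸1 ⟩
      (n ∸ 1) ^ 4     ∎

  certificate-r≥m : 4 * r < x + 4 → m ≤ r → Certificate n
  certificate-r≥m 4r<x+4 m≤r =
    narrow-residue-certificate 1 4r<n (subst (m ≤_) (sym (*-identityˡ r)) m≤r)
    where
    open ≤-Reasoning
    x≡4*2^[m-2] : x ≡ 4 * 2 ^ (m-1 ∸ 1)
    x≡4*2^[m-2] = trans (cong (λ e → 2 * 2 ^ e) (sym (m+[n∸m]≡n (≤-trans (s≤s z≤n) 4≤m-1))))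
                        (sym (*-assoc 2 2 (2 ^ (m-1 ∸ 1))))
    r≤2^[m-2] : r ≤ 2 ^ (m-1 ∸ 1)
    r≤2^[m-2] = s≤s⁻¹ (*-cancelˡ-< 4 r (suc (2 ^ (m-1 ∸ 1))) (begin-strict
      4 * r                         <⟨ 4r<x+4 ⟩
      x + 4                         ≡⟨ cong (_+ 4) x≡4*2^[m-2] ⟩
      4 * 2 ^ (m-1 ∸ 1) + 4         ≡⟨ +-comm (4 * 2 ^ (m-1 ∸ 1)) 4 ⟩
      4 + 4 * 2 ^ (m-1 ∸ 1)         ≡⟨ sym (*-suc 4 (2 ^ (m-1 ∸ 1))) ⟩
      4 * suc (2 ^ (m-1 ∸ 1))       ∎))
    4r<n : 2 ^ 2 * r < n
    4r<n = begin-strict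
      4 * r             ≤⟨ *-monoʳ-≤ 4 r≤2^[m-2] ⟩
      4 * 2 ^ (m-1 ∸ 1) ≡⟨ sym x≡4*2^[m-2] ⟩
      x                 <⟨ x<n ⟩
      n                 ∎

  certificate-r<m≤2r : r < m → m ≤ 2 * r → Certificate n
  certificate-r<m≤2r r<m m≤2r = narrow-residue-certificate 2 8r<n m≤2r
    where
    open ≤-Reasoning
    7r<x : 7 * r < x
    7r<x = begin-strict
      7 * r          ≤⟨ *-monoʳ-≤ 7 (s≤s⁻¹ r<m) ⟩
      7 * m-1        <⟨ m<m+n (7 * m-1) z<s ⟩
      7 * m-1 + 1    ≤⟨ linear≤exponential 7 1 2 (≤ᵇ⇒≤ 29 32 _) (≤ᵇ⇒≤ 7 32 _) 4≤m-1 ⟩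
      2 * 2 ^ m-1    ∎
    8r<n : 2 ^ 3 * r < n
    8r<n = begin-strict
      2 ^ 3 * r ≡⟨ regroup r ⟩
      7 * r + r <⟨ +-monoˡ-< r 7r<x ⟩
      n         ∎
      where
      regroup : ∀ r → 8 * r ≡ 7 * r + r
      regroup = solve-∀

  certificate-2r<m : 2 * r < m → Certificate n
  certificate-2r<m 2r<m = narrow-residue-certificate (m ∸ r) 2^[1+m-r]r<n m≤[m-r]r
    where
    open ≤-Reasoning
    r≤m : r ≤ m
    r≤m = ≤-trans (m≤n+m r r) (≤-trans (≤-reflexive (sym (2*n≡n+n r))) (<⇒≤ 2r<m))
    2^[1+m-r]r<n : 2 ^ suc (m ∸ r) * r < n
    2^[1+m-r]r<n = begin-strict
      2 ^ suc (m ∸ r) * r     ≡⟨ *-assoc 2 (2 ^ (m ∸ r)) r ⟩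
      2 * (2 ^ (m ∸ r) * r)   ≡⟨ x∙yz≈y∙xz 2 (2 ^ (m ∸ r)) r ⟩
      2 ^ (m ∸ r) * (2 * r)   ≤⟨ *-monoʳ-≤ (2 ^ (m ∸ r)) 2r≤2^r ⟩
      2 ^ (m ∸ r) * 2 ^ r     ≡⟨ sym (^-distribˡ-+-* 2 (m ∸ r) r) ⟩
      2 ^ (m ∸ r + r)         ≡⟨ cong (2 ^_) (m∸n+n≡m r≤m) ⟩
      x                       <⟨ x<n ⟩
      n                       ∎
      where
      2r≤2^r : 2 * r ≤ 2 ^ r
      2r≤2^r = subst (2 * r ≤_) (*-identityˡ (2 ^ r))
        (subst (_≤ 1 * 2 ^ r) (+-identityʳ (2 * r))
          (linear≤exponential 2 0 1 ≤-refl ≤-refl (≤-trans (s≤s z≤n) 2≤r)))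
    m≤[m-r]r : m ≤ (m ∸ r) * r
    m≤[m-r]r = ≤-trans m≤[m-r]2 (*-monoʳ-≤ (m ∸ r) 2≤r)
      where
      m≤[m-r]2 : m ≤ (m ∸ r) * 2
      m≤[m-r]2 = +-cancelʳ-≤ (2 * r) m ((m ∸ r) * 2) (begin
        m + 2 * r                   ≤⟨ +-monoʳ-≤ m (<⇒≤ 2r<m) ⟩
        m + m                       ≡⟨ cong (λ a → a + a) (sym (m∸n+n≡m r≤m)) ⟩
        (m ∸ r + r) + (m ∸ r + r)   ≡⟨ regroup (m ∸ r) r ⟩
        (m ∸ r) * 2 + 2 * r         ∎)
        where
        regroup : ∀ a r → (a + r) + (a + r) ≡ a * 2 + 2 * r
        regroup = solve-∀

  odd-certificate : Certificate n
  odd-certificate with x + 4 ≤? 4 * r | m ≤? r | m ≤? 2 * r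
  ... | yes x+4≤4r | _       | _       = wide-residue-certificate x+4≤4r
  ... | no x+4≰4r  | yes m≤r | _       = certificate-r≥m (≰⇒> x+4≰4r) m≤r
  ... | no _       | no m≰r  | yes m≤2r = certificate-r<m≤2r (≰⇒> m≰r) m≤2r
  ... | no _       | no _    | no m≰2r  = certificate-2r<m (≰⇒> m≰2r)

-- Fermat numbers

-- For n = 2^m + 1 the orbit of 1 is periodic: m doublings lead to 2^m, whose
-- orbit is complementary to that of 1, so after m more tosses it is back at 1.
module FermatNumber (m-1 : ℕ) where

  open TwoPowerPlus m-1 1 (s≤s z≤n) using (m; x; n; orbit-m; tosses-m)

  cost period : ℕ
  cost = 2 * n + x * m
  period = m + m

  instance
    n≢0 : NonZero n
    n≢0 = >-nonZero (m≤n+m 1 x)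

  n-odd : ¬ 2 ∣ n
  n-odd 2∣n = <⇒≱ (s≤s (s≤s z≤n)) (∣⇒≤ (∣m+n∣m⇒∣n 2∣n (m∣m*n (2 ^ m-1))))

  orbit-period : orbit n 1 period ≡ 1
  orbit-period = begin
    orbit n 1 (m + m)       ≡⟨ orbit-+ n 1 m m ⟩
    orbit n (orbit n 1 m) m ≡⟨ cong (λ y → orbit n y m) orbit-m ⟩
    orbit n x m             ≡⟨ +-cancelˡ-≡ x _ _ complement ⟩
    1                       ∎
    where
    open ≡-Reasoning
    complement : x + orbit n x m ≡ x + 1
    complement = trans (+-comm x _)
      (trans (cong (orbit n x m +_) (sym orbit-m)) (orbit-complement n-odd x 1 refl m))

  tosses-period : n * tosses n 1 period + cost ≡ cost * 2 ^ period
  tosses-period = +-cancelʳ-≡ (n * (a + 2 * n)) _ _ (begin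
    n * tosses n 1 (m + m) + cost + n * (a + 2 * n)
      ≡⟨ cong (λ t → n * t + cost + n * (a + 2 * n)) split ⟩
    n * (x * a + b) + cost + n * (a + 2 * n)
      ≡⟨ regroup n x a b cost ⟩
    n * x * a + n * (b + a + 2 * n) + cost
      ≡⟨ cong (λ s → n * x * a + n * s + cost) (tosses-complement n-odd x 1 refl m) ⟩
    n * x * a + n * (2 * n * x) + cost
      ≡⟨ cong (λ a → n * x * a + n * (2 * n * x) + cost) tosses-m ⟩
    n * x * (m * x) + n * (2 * n * x) + cost
      ≡⟨ identity x m ⟩
    cost * (x * x) + n * (m * x + 2 * n)
      ≡⟨ cong₂ (λ p a → cost * p + n * (a + 2 * n)) (sym (^-distribˡ-+-* 2 m m)) (sym tosses-m) ⟩
    cost * 2 ^ (m + m) + n * (a + 2 * n) ∎)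
    where
    open ≡-Reasoning
    a b : ℕ
    a = tosses n 1 m
    b = tosses n x m
    split : tosses n 1 (m + m) ≡ x * a + b
    split = trans (tosses-+ n 1 m m) (cong (λ y → x * a + tosses n y m) orbit-m)
    regroup : ∀ n x a b c → n * (x * a + b) + c + n * (a + 2 * n) ≡ n * x * a + n * (b + a + 2 * n) + c
    regroup = solve-∀
    identity : ∀ x m →
      (x + 1) * x * (m * x) + (x + 1) * (2 * (x + 1) * x) + (2 * (x + 1) + x * m)
        ≡ (2 * (x + 1) + x * m) * (x * x) + (x + 1) * (m * x + 2 * (x + 1))
    identity = solve-∀

  tosses-periods : ∀ j → n * tosses n 1 (period * j) + cost ≡ cost * 2 ^ (period * j)
  tosses-periods = tosses-periodic {n} {1} {period} orbit-period {n} {cost} tosses-period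

  tosses≤ : ∀ t → n * tosses n 1 t ≤ 2 ^ t * cost
  tosses≤ t = tosses-bound-≤ {n} {1} {n} (m≤n*m t period) (begin
    n * tosses n 1 (period * t)        ≤⟨ m≤m+n _ cost ⟩
    n * tosses n 1 (period * t) + cost ≡⟨ tosses-periods t ⟩
    cost * 2 ^ (period * t)            ≡⟨ *-comm cost _ ⟩
    2 ^ (period * t) * cost            ∎)
    where open ≤-Reasoning

  certificate : Certificate n
  certificate = record
    { scale = n ; cost = cost ; p = m ; q = 1
    ; q≤p = s≤s z≤n
    ; tosses≤ = tosses≤
    ; excess≤ = ≤-reflexive excess
    ; 2^p≤ = ≤-reflexive (sym (trans (*-identityʳ (n ∸ 1)) (m+n∸n≡m x 1)))
    }
    where
    open ≡-Reasoning
    excess : (cost ∸ 2 * n) * n * 1 ≡ n * (n ∸ 1) * m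
    excess = begin
      (cost ∸ 2 * n) * n * 1 ≡⟨ cong (λ e → e * n * 1) (m+n∸m≡n (2 * n) (x * m)) ⟩
      x * m * n * 1          ≡⟨ regroup x m n ⟩
      n * x * m              ≡⟨ cong (λ y → n * y * m) (sym (m+n∸n≡m x 1)) ⟩
      n * (n ∸ 1) * m        ∎
      where
      regroup : ∀ x m n → x * m * n * 1 ≡ n * x * m
      regroup = solve-∀

  num≤ : ∀ t → num n t * n ≤ cost * 2 ^ t
  num≤ t = begin
    num n t * n      ≤⟨ *-monoˡ-≤ n (num≤tosses n t) ⟩
    tosses n 1 t * n ≡⟨ *-comm (tosses n 1 t) n ⟩
    n * tosses n 1 t ≤⟨ tosses≤ t ⟩
    2 ^ t * cost     ≡⟨ *-comm (2 ^ t) cost ⟩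
    cost * 2 ^ t     ∎
    where open ≤-Reasoning

  num-periods : ∀ j → num n (period * j) * n + (n * (period * j) + cost) ≡ cost * 2 ^ (period * j)
  num-periods j = begin
    num n t * n + (n * t + cost)         ≡⟨ regroup (num n t) n t cost ⟩
    n * (num n t + t * 1) + cost         ≡⟨ cong (λ u → n * (num n t + t * u) + cost) (sym undecided-t) ⟩
    n * (num n t + t * undecided n t) + cost ≡⟨ cong (λ a → n * a + cost) (sym (tosses-1 n t)) ⟩
    n * tosses n 1 t + cost              ≡⟨ tosses-periods j ⟩
    cost * 2 ^ t                         ∎
    where
    open ≡-Reasoning
    t : ℕ
    t = period * j
    undecided-t : undecided n t ≡ 1
    undecided-t = trans (sym (orbit-1 n t)) (orbit-periodic {n} {1} {period} orbit-period j)
    regroup : ∀ a n t c → a * n + (n * t + c) ≡ n * (a + t * 1) + c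
    regroup = solve-∀

  -- Along the periods the deficit cost·2^t − n·num n t equals n·t + cost,
  -- which is eventually negligible against n·2^t.
  num-close : ∀ k → ∃[ t ] (cost * 2 ^ t ∸ num n t * n) * suc k < n * 2 ^ t
  num-close k = t , (begin-strict
    (cost * 2 ^ t ∸ num n t * n) * suc k ≡⟨ cong (_* suc k) deficit ⟩
    (n * t + cost) * suc k               ≤⟨ *-mono-≤ (+-monoʳ-≤ (n * t) cost≤nt) 1+k≤t ⟩
    (n * t + n * t) * t                  ≡⟨ regroup n t ⟩
    n * (2 * (t * t))                    <⟨ *-monoʳ-< n (quadratic<exponential 7≤t) ⟩
    n * 2 ^ t                            ∎)
    where
    open ≤-Reasoning
    j t : ℕ
    j = 7 + (cost + k)
    t = period * j
    j≤t : j ≤ t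
    j≤t = m≤n*m j period
    deficit : cost * 2 ^ t ∸ num n t * n ≡ n * t + cost
    deficit = trans (cong (_∸ num n t * n) (sym (num-periods j)))
                    (m+n∸m≡n (num n t * n) (n * t + cost))
    cost≤nt : cost ≤ n * t
    cost≤nt = ≤-trans (≤-trans (m≤m+n cost k) (m≤n+m (cost + k) 7)) (≤-trans j≤t (m≤n*m t n))
    1+k≤t : suc k ≤ t
    1+k≤t = ≤-trans (s≤s (≤-trans (m≤n+m k cost) (m≤n+m (cost + k) 6))) j≤t
    7≤t : 7 ≤ t
    7≤t = ≤-trans (m≤m+n 7 (cost + k)) j≤t
    regroup : ∀ n t → (n * t + n * t) * t ≡ n * (2 * (t * t))
    regroup = solve-∀

binary-decomposition : ∀ n → 33 ≤ n → ¬ 2 ∣ n →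
  ∃[ m-1 ] ∃[ r ] 4 ≤ m-1 × 0 < r × r < 2 ^ suc m-1 × 2 ^ suc m-1 + r ≡ n
binary-decomposition n 33≤n n-odd
  with power-of-two-below (n ∸ 1) (≤-trans (s≤s z≤n) (∸-monoˡ-≤ 1 33≤n))
... | zero , _ , n∸1<2 =
  contradiction (≤-trans (∸-monoˡ-≤ 1 33≤n) (s≤s⁻¹ n∸1<2)) (<⇒≱ (≤ᵇ⇒≤ 2 32 _))
... | suc m-1 , x≤n∸1 , n∸1<2x = m-1 , r , 4≤m-1 , 0<r , r<x , x+r≡n
  where
  x r : ℕ
  x = 2 ^ suc m-1
  r = n ∸ x
  1+[n∸1]≡n : suc (n ∸ 1) ≡ n
  1+[n∸1]≡n = m+[n∸m]≡n (≤-trans (s≤s z≤n) 33≤n)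
  x<n : x < n
  x<n = subst (x <_) 1+[n∸1]≡n (s≤s x≤n∸1)
  x+r≡n : x + r ≡ n
  x+r≡n = m+[n∸m]≡n (<⇒≤ x<n)
  0<r : 0 < r
  0<r = m<n⇒0<n∸m x<n
  4≤m-1 : 4 ≤ m-1
  4≤m-1 with 4 ≤? m-1
  ... | yes 4≤m-1 = 4≤m-1
  ... | no 4≰m-1  = contradiction (∸-monoˡ-≤ 1 33≤n)
                      (<⇒≱ (≤-trans n∸1<2x (^-monoʳ-≤ 2 (s≤s (≰⇒> 4≰m-1)))))
  r≤x : r ≤ x
  r≤x = +-cancelˡ-≤ x r x (subst₂ _≤_ (sym x+r≡n) (2*n≡n+n x) (subst (_≤ 2 * x) 1+[n∸1]≡n n∸1<2x))
  r≢x : r ≢ x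
  r≢x r≡x = n-odd (divides x (begin
    n      ≡⟨ sym x+r≡n ⟩
    x + r  ≡⟨ cong (x +_) r≡x ⟩
    x + x  ≡⟨ sym (2*n≡n+n x) ⟩
    2 * x  ≡⟨ *-comm 2 x ⟩
    x * 2  ∎))
    where open ≡-Reasoning
  r<x : r < x
  r<x = ≤∧≢⇒< r≤x r≢x

large-odd-certificate : ∀ n → 33 ≤ n → ¬ 2 ∣ n → Certificate n
large-odd-certificate n 33≤n n-odd with binary-decomposition n 33≤n n-odd
... | m-1 , suc zero , _ , _ , _ , refl = FermatNumber.certificate m-1
... | m-1 , r@(suc (suc _)) , 4≤m-1 , _ , r<x , refl =
  odd-certificate m-1 r 4≤m-1 (s≤s (s≤s z≤n)) r<x n-odd

certificate-≥3 : ∀ n → 3 ≤ n → Certificate n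
certificate-≥3 = <-rec (λ n → 3 ≤ n → Certificate n) certify
  where
  certify : ∀ n → (∀ {h} → h < n → 3 ≤ h → Certificate h) → 3 ≤ n → Certificate n
  certify n rec 3≤n with n <? 33 | 2 ∣? n
  ... | yes n<33 | _        = valid⇒certificate n (tableEntry n) (table-valid n<33 3≤n)
  ... | no n≮33  | no n-odd = large-odd-certificate n (≮⇒≥ n≮33) n-odd
  ... | no n≮33  | yes (divides h refl) =
    subst Certificate (*-comm 2 h) (double-certificate h (≤-trans (n≤1+n 2) 3≤h) (rec h<2h 3≤h))
    where
    3≤h : 3 ≤ h
    3≤h with 3 ≤? h
    ... | yes 3≤h = 3≤h
    ... | no 3≰h  = contradiction (≤-trans (≮⇒≥ n≮33) (*-monoˡ-≤ 2 (s≤s⁻¹ (≰⇒> 3≰h))))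
                                  (<⇒≱ (≤ᵇ⇒≤ 5 33 _))
    h<2h : h < h * 2
    h<2h = subst (h <_) (trans (sym (2*n≡n+n h)) (*-comm 2 h))
                 (m<m+n h (≤-trans (s≤s z≤n) 3≤h))

eLeBound-2 : eLeBound 2
eLeBound-2 t = subst (λ e → 2 ^ (e * 2) ≤ 1 ^ (2 ^ t * 1)) (sym (m≤n⇒m∸n≡0 num≤))
                     (≤-reflexive (sym (^-zeroˡ (2 ^ t * 1))))
  where
  open ≤-Reasoning
  descent : ∀ {u} → u < 2 → 2 * step 2 u + 2 * 1 * u ≤ 2 * (2 * u)
  descent {0} _ = z≤n
  descent {1} _ = ≤ᵇ⇒≤ 2 4 _
  descent {2+ _} (s≤s (s≤s ()))
  num≤ : num 2 t ≤ 2 * 2 ^ t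
  num≤ = begin
    num 2 t                                ≤⟨ num≤tosses 2 t ⟩
    tosses 2 1 t                           ≡⟨ sym (*-identityˡ _) ⟩
    1 * tosses 2 1 t                       ≤⟨ m≤m+n _ _ ⟩
    1 * tosses 2 1 t + 2 * orbit 2 1 t     ≤⟨ potential-bound 1 2 (2 *_) (s≤s (s≤s z≤n)) descent ≤-refl t ⟩
    2 ^ t * 2                              ≡⟨ *-comm (2 ^ t) 2 ⟩
    2 * 2 ^ t                              ∎

eLeBound-≥2 : ∀ n → 2 ≤ n → eLeBound n
eLeBound-≥2 (suc zero)            (s≤s ())
eLeBound-≥2 (suc (suc zero))      _   = eLeBound-2
eLeBound-≥2 n@(suc (suc (suc _))) _ = certificate⇒eLeBound (certificate-≥3 n (s≤s (s≤s (s≤s z≤n))))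

[n∸1]^[n∸1]<n^n : ∀ n → 2 ≤ n → (n ∸ 1) ^ (n ∸ 1) < n ^ n
[n∸1]^[n∸1]<n^n (suc zero) (s≤s ())
[n∸1]^[n∸1]<n^n n@(suc n-1@(suc _)) _ = begin-strict
  n-1 ^ n-1     ≤⟨ ^-monoˡ-≤ n-1 (n≤1+n n-1) ⟩
  n ^ n-1       <⟨ m<m*n (n ^ n-1) n {{m^n≢0 n n-1}} (s≤s (s≤s z≤n)) ⟩
  n ^ n-1 * n   ≡⟨ *-comm (n ^ n-1) n ⟩
  n ^ n         ∎
  where open ≤-Reasoning

proposition9 :
    (∀ n → 2 ≤ n → eLeBound n × BoundLtTwoPlusLog n) ×
    (∀ m → 1 ≤ m →
      eEquals (2 ^ m + 1) (2 * (2 ^ m + 1) + 2 ^ m * m) (2 ^ m + 1))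
proposition9 = (λ n 2≤n → eLeBound-≥2 n 2≤n , [n∸1]^[n∸1]<n^n n 2≤n) , fermat
  where
  fermat : ∀ m → 1 ≤ m → eEquals (2 ^ m + 1) (2 * (2 ^ m + 1) + 2 ^ m * m) (2 ^ m + 1)
  fermat (suc m-1) _ = FermatNumber.num≤ m-1 , FermatNumber.num-close m-1
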